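{- Let $(K,+)$ be a finite abelian group, let ${\cal Z}\subsetneq K$ be a proper subset, and let ${\cal N}=K\setminus{\cal Z}$. Then $\delta(K,{\cal Z})$ equals the largest integer $t$ for which there exists a sequence in $K$ of ${\cal N}$-rank $t$.
   Context: ${\cal Z}$-independent subsets of $K$ are defined inductively: $\emptyset$ is ${\cal Z}$-independent; if ${\cal A}$ is ${\cal Z}$-independent and $\psi\in K$ then $\psi+{\cal A}$ is ${\cal Z}$-independent; if ${\cal A}\subseteq{\cal Z}$ is ${\cal Z}$-independent and $\eta\in K\setminus{\cal Z}$ then ${\cal A}\cup\{\eta\}$ is ${\cal Z}$-independent; only sets so obtained are ${\cal Z}$-independent. $\delta(K,{\cal Z})$ is the largest size of a ${\cal Z}$-independent subset of $K$. A sequence $\alpha_1,\dots,\alpha_t$ in $K$ has ${\cal N}$-rank $t$ if $\alpha_i+{\cal N}\not\subseteq(\alpha_1+{\cal N})\cup\cdots\cup(\alpha_{i-1}+{\cal N})$ for $i=2,\dots,t$. (In the paper $K=\hat G$ is the character group of a finite abelian group.) -}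

module Defs where

open import Level using (0ℓ)
open import Data.Nat using (ℕ; _≤_; _<_)
open import Data.Fin using (Fin; toℕ)
open import Data.Fin.Subset using (Subset; _∈_; _∉_; _⊆_; _∪_; ⁅_⁆; ⊥; ∣_∣)
open import Data.Product using (Σ; ∃; _×_)
open import Relation.Binary.PropositionalEquality using (_≡_)
open import Relation.Nullary using (¬_)
open import Algebra.Core using (Op₁; Op₂)
open import Algebra.Structures using (IsAbelianGroup)

-- A finite abelian group of order n, with carrier Fin n
-- (every finite abelian group is isomorphic to one of this form).
record FinAbGroup (n : ℕ) : Set where
  field
    _+_ : Op₂ (Fin n)
    0#  : Fin n
    -_  : Op₁ (Fin n)
    isAbelianGroup : IsAbelianGroup _≡_ _+_ 0# -_

module _ {n : ℕ} (K : FinAbGroup n) where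
  open FinAbGroup K

  IsTranslate : Fin n → Subset n → Subset n → Set
  IsTranslate ψ A B = ∀ x → (x ∈ B → ∃ λ a → a ∈ A × x ≡ ψ + a)
                          × ((∃ λ a → a ∈ A × x ≡ ψ + a) → x ∈ B)

  data IsIndep (Z : Subset n) : Subset n → Set where
    indep-∅     : IsIndep Z ⊥
    indep-trans : ∀ {A B} (ψ : Fin n) → IsIndep Z A → IsTranslate ψ A B → IsIndep Z B
    indep-add   : ∀ {A} (η : Fin n) → IsIndep Z A → A ⊆ Z → η ∉ Z → IsIndep Z (A ∪ ⁅ η ⁆)

  InShiftN : Subset n → Fin n → Fin n → Set
  InShiftN Z α x = ∃ λ ν → ν ∉ Z × x ≡ α + ν

  -- the sequence α₁,…,α_t (indexed by Fin t) has 𝒩-rank t: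
  -- for every index i ≥ 2 (i.e. toℕ i ≥ 1), α_i + 𝒩 ⊄ ⋃_{j<i} (α_j + 𝒩)
  HasNRank : (Z : Subset n) (t : ℕ) → (Fin t → Fin n) → Set
  HasNRank Z t α = ∀ (i : Fin t) → 1 ≤ toℕ i →
    ∃ λ x → InShiftN Z (α i) x × (∀ (j : Fin t) → toℕ j < toℕ i → ¬ InShiftN Z (α j) x)

  IsDelta : Subset n → ℕ → Set
  IsDelta Z d = (∃ λ A → IsIndep Z A × ∣ A ∣ ≡ d) × (∀ A → IsIndep Z A → ∣ A ∣ ≤ d)

  IsMaxNRank : Subset n → ℕ → Set
  IsMaxNRank Z d = (∃ λ (α : Fin d → Fin n) → HasNRank Z d α)
                 × (∀ t (α : Fin t → Fin n) → HasNRank Z t α → t ≤ d)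

-- An independent set is always of the form c − {α₁,…,αₜ} with α of 𝒩-rank t:
-- a translation moves c, and adjoining η ∉ 𝒵 to A ⊆ 𝒵 appends c − η, which is
-- legal because c ∈ (c − η) + 𝒩 while c ∉ αⱼ + 𝒩 (as c − αⱼ ∈ A ⊆ 𝒵).
-- Conversely a sequence of 𝒩-rank t yields such a set, built by adjoining the
-- differences one at a time, each time translating to the point y witnessing
-- the rank condition.  The αᵢ are distinct, so both sizes are t, and the common
-- maximum exists because ranks are bounded by |K| and rank is decidable.
module Submission where

open import Defs
open import Level using (0ℓ)
open import Algebra.Bundles using (AbelianGroup)
open import Algebra.Structures using (IsAbelianGroup)
open import Data.Nat using (ℕ; zero; suc; _≤_; _<_; z≤n; s≤s; _≤?_; _<?_)
open import Data.Nat.Properties using (≤-pred; ≤∧≢⇒<; ≰⇒>; <-cmp; <-irrefl; <-asym; ≤-trans)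
open import Data.Fin using (Fin; zero; suc; toℕ; fromℕ; inject₁)
open import Data.Fin.Properties
  using (toℕ-injective; toℕ-inject₁; toℕ-fromℕ; inject₁ℕ<; inject₁-injective; fromℕ≢inject₁;
         any?; all?; pigeonhole; <⇒≢)
open import Data.Fin.Relation.Unary.Top using (view; ‵fromℕ; ‵inject₁)
open import Data.Fin.Subset using (Subset; _∈_; _∉_; _⊆_; _∪_; ⁅_⁆; ⊥; ∣_∣; inside; outside)
open import Data.Fin.Subset.Properties
  using (_∈?_; ⊆-antisym; x∈p∪q⁺; x∈p∪q⁻; x∈⁅y⁆⇒x≡y; x∈⁅x⁆; ∉⊥; ∪-identityʳ; ∣⊥∣≡0)
open import Data.Vec.Base using (_∷_; here; there)
open import Data.Vec.Functional as Vector using (Vector; init; last)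
open import Data.Product using (Σ; ∃; _×_; _,_; proj₁; proj₂; curry)
open import Data.Sum using (inj₁; inj₂)
open import Data.Empty using (⊥-elim)
open import Function using (_∘_; Injective)
open import Relation.Binary using (tri<; tri≈; tri>)
open import Relation.Binary.PropositionalEquality
open import Relation.Nullary using (¬_; Dec; yes; no)
open import Relation.Nullary.Decidable using (_×-dec_; _→-dec_; ¬?; map′; decidable-stable)
open import Relation.Unary using (Pred; Decidable)

∣p∪⁅x⁆∣≡1+∣p∣ : ∀ {m} (p : Subset m) (x : Fin m) → x ∉ p → ∣ p ∪ ⁅ x ⁆ ∣ ≡ suc ∣ p ∣
∣p∪⁅x⁆∣≡1+∣p∣ (outside ∷ p) zero    x∉p = cong (suc ∘ ∣_∣) (∪-identityʳ p)
∣p∪⁅x⁆∣≡1+∣p∣ (inside  ∷ p) zero    x∉p = ⊥-elim (x∉p here)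
∣p∪⁅x⁆∣≡1+∣p∣ (outside ∷ p) (suc x) x∉p = ∣p∪⁅x⁆∣≡1+∣p∣ p x (x∉p ∘ there)
∣p∪⁅x⁆∣≡1+∣p∣ (inside  ∷ p) (suc x) x∉p = cong suc (∣p∪⁅x⁆∣≡1+∣p∣ p x (x∉p ∘ there))

module _ {A : Set} where

  infixl 5 _∷ʳ_
  _∷ʳ_ : ∀ {t} → Vector A t → A → Vector A (suc t)
  _∷ʳ_ {zero}  α a zero    = a
  _∷ʳ_ {suc t} α a zero    = α zero
  _∷ʳ_ {suc t} α a (suc i) = (α ∘ suc ∷ʳ a) i

  init-∷ʳ : ∀ {t} (α : Vector A t) (a : A) → init (α ∷ʳ a) ≗ α
  init-∷ʳ {suc t} α a zero    = refl
  init-∷ʳ {suc t} α a (suc i) = init-∷ʳ (α ∘ suc) a i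

  last-∷ʳ : ∀ {t} (α : Vector A t) (a : A) → last (α ∷ʳ a) ≡ a
  last-∷ʳ {zero}  α a = refl
  last-∷ʳ {suc t} α a = last-∷ʳ (α ∘ suc) a

any-vector? : ∀ {m} t (P : Pred (Vector (Fin m) t) 0ℓ) →
              (∀ {α β} → α ≗ β → P α → P β) → Decidable P → Dec (∃ P)
any-vector? zero P resp P? =
  map′ (Vector.[] ,_) (λ (α , p) → resp {β = Vector.[]} (λ ()) p) (P? Vector.[])
any-vector? (suc t) P resp P? =
  map′ (λ (a , β , p) → a Vector.∷ β , p)
       (λ (α , p) → Vector.head α , Vector.tail α , resp (λ { zero → refl ; (suc i) → refl }) p)
       (any? λ a → any-vector? t (P ∘ (a Vector.∷_))
                     (λ β≗β' → resp λ { zero → refl ; (suc i) → β≗β' i }) (P? ∘ (a Vector.∷_)))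

largest : (P : Pred ℕ 0ℓ) → Decidable P → P 0 → ∀ k → (∀ t → P t → t ≤ k) →
          ∃ λ d → P d × (∀ t → P t → t ≤ d)
largest P P? p₀ k bounded with P? k
... | yes pₖ = k , pₖ , bounded
largest P P? p₀ zero    bounded | no ¬p₀ = ⊥-elim (¬p₀ p₀)
largest P P? p₀ (suc k) bounded | no ¬pₖ₊₁ = largest P P? p₀ k λ t pₜ →
  ≤-pred (≤∧≢⇒< (bounded t pₜ) λ { refl → ¬pₖ₊₁ pₜ })

inject₁<fromℕ : ∀ {t} (j : Fin t) → toℕ (inject₁ j) < toℕ (fromℕ t)
inject₁<fromℕ {t} j = subst (toℕ (inject₁ j) <_) (sym (toℕ-fromℕ t)) (inject₁ℕ< j)

module Differences {n} (K : FinAbGroup n) where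
  open FinAbGroup K
  open IsAbelianGroup isAbelianGroup using (assoc; comm)

  private
    abelianGroup : AbelianGroup 0ℓ 0ℓ
    abelianGroup = record { isAbelianGroup = isAbelianGroup }

  open import Algebra.Properties.AbelianGroup abelianGroup
    using (//-rightDividesˡ; //-rightDividesʳ; ⁻¹-injective; quasigroup)
  open import Algebra.Properties.Quasigroup quasigroup using (cancelˡ)

  _−_ : Fin n → Fin n → Fin n
  x − y = x + (- y)

  x−y+y≡x : ∀ x y → (x − y) + y ≡ x
  x−y+y≡x x y = //-rightDividesˡ y x

  a+ν≡x⇒ν≡x−a : ∀ {a ν x} → a + ν ≡ x → ν ≡ x − a
  a+ν≡x⇒ν≡x−a {a} {ν} refl = begin
    ν              ≡⟨ //-rightDividesʳ a ν ⟨
    (ν + a) − a    ≡⟨ cong (_− a) (comm ν a) ⟩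
    (a + ν) − a    ∎
    where open ≡-Reasoning

  x≡a+[x−a] : ∀ x a → x ≡ a + (x − a)
  x≡a+[x−a] x a = trans (sym (x−y+y≡x x a)) (comm (x − a) a)

  x−[x−y]≡y : ∀ x y → x − (x − y) ≡ y
  x−[x−y]≡y x y = sym (a+ν≡x⇒ν≡x−a (x−y+y≡x x y))

  x−a≡x−b⇒a≡b : ∀ {x a b} → x − a ≡ x − b → a ≡ b
  x−a≡x−b⇒a≡b {x} e = ⁻¹-injective (cancelˡ x _ _ e)

  _−ˢ_ : Fin n → ∀ {t} → Vector (Fin n) t → Subset n
  _−ˢ_ c {zero}  α = ⊥
  _−ˢ_ c {suc t} α = (c −ˢ init α) ∪ ⁅ c − last α ⁆

  ∈-−ˢ⁻ : ∀ c {t} (α : Vector (Fin n) t) {x} → x ∈ (c −ˢ α) → ∃ λ i → x ≡ c − α i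
  ∈-−ˢ⁻ c {zero}  α x∈ = ⊥-elim (∉⊥ x∈)
  ∈-−ˢ⁻ c {suc t} α x∈ with x∈p∪q⁻ (c −ˢ init α) _ x∈
  ... | inj₁ x∈init = let (j , e) = ∈-−ˢ⁻ c (init α) x∈init in inject₁ j , e
  ... | inj₂ x∈last = fromℕ t , x∈⁅y⁆⇒x≡y _ x∈last

  ∈-−ˢ⁺ : ∀ c {t} (α : Vector (Fin n) t) i → c − α i ∈ (c −ˢ α)
  ∈-−ˢ⁺ c {suc t} α i with view i
  ... | ‵fromℕ     = x∈p∪q⁺ (inj₂ (x∈⁅x⁆ _))
  ... | ‵inject₁ j = x∈p∪q⁺ (inj₁ (∈-−ˢ⁺ c (init α) j))

  −ˢ-cong : ∀ c {t} {α β : Vector (Fin n) t} → α ≗ β → (c −ˢ α) ≡ (c −ˢ β)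
  −ˢ-cong c {zero}  α≗β = refl
  −ˢ-cong c {suc t} α≗β =
    cong₂ _∪_ (−ˢ-cong c (α≗β ∘ inject₁)) (cong (⁅_⁆ ∘ (c −_)) (α≗β (fromℕ t)))

  ∣−ˢ∣ : ∀ c {t} (α : Vector (Fin n) t) → Injective _≡_ _≡_ α → ∣ c −ˢ α ∣ ≡ t
  ∣−ˢ∣ c {zero}  α α-inj = ∣⊥∣≡0 n
  ∣−ˢ∣ c {suc t} α α-inj = begin
    ∣ (c −ˢ init α) ∪ ⁅ c − last α ⁆ ∣  ≡⟨ ∣p∪⁅x⁆∣≡1+∣p∣ _ _ last∉init ⟩
    suc ∣ c −ˢ init α ∣                 ≡⟨ cong suc (∣−ˢ∣ c (init α) (inject₁-injective ∘ α-inj)) ⟩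
    suc t                               ∎
    where
    open ≡-Reasoning
    last∉init : c − last α ∉ (c −ˢ init α)
    last∉init x∈ = let (j , e) = ∈-−ˢ⁻ c (init α) x∈ in fromℕ≢inject₁ (α-inj (x−a≡x−b⇒a≡b e))

  −ˢ-translate : ∀ ψ c {t} (α : Vector (Fin n) t) → IsTranslate K ψ (c −ˢ α) ((ψ + c) −ˢ α)
  −ˢ-translate ψ c α x = to , from
    where
    to : x ∈ ((ψ + c) −ˢ α) → ∃ λ a → a ∈ (c −ˢ α) × x ≡ ψ + a
    to x∈ = let (i , e) = ∈-−ˢ⁻ (ψ + c) α x∈ in
      c − α i , ∈-−ˢ⁺ c α i , trans e (assoc ψ c (- α i))
    from : (∃ λ a → a ∈ (c −ˢ α) × x ≡ ψ + a) → x ∈ ((ψ + c) −ˢ α)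
    from (a , a∈ , e) = let (i , e′) = ∈-−ˢ⁻ c α a∈ in
      subst (_∈ ((ψ + c) −ˢ α)) (sym (trans e (trans (cong (ψ +_) e′) (sym (assoc ψ c (- α i))))))
        (∈-−ˢ⁺ (ψ + c) α i)

  IsTranslate-functional : ∀ {ψ A B B′} → IsTranslate K ψ A B → IsTranslate K ψ A B′ → B ≡ B′
  IsTranslate-functional T T′ =
    ⊆-antisym (λ {x} x∈ → proj₂ (T′ x) (proj₁ (T x) x∈)) (λ {x} x∈ → proj₂ (T x) (proj₁ (T′ x) x∈))

module Correspondence {n} (K : FinAbGroup n) (Z : Subset n) where
  open FinAbGroup K
  open Differences K

  InShiftN-cong : ∀ {a b x} → a ≡ b → InShiftN K Z a x → InShiftN K Z b x
  InShiftN-cong refl x∈ = x∈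

  InShiftN⇒∉ : ∀ {a x} → InShiftN K Z a x → x − a ∉ Z
  InShiftN⇒∉ (ν , ν∉Z , refl) = subst (_∉ Z) (a+ν≡x⇒ν≡x−a refl) ν∉Z

  ∉⇒InShiftN : ∀ {a x} → x − a ∉ Z → InShiftN K Z a x
  ∉⇒InShiftN {a} {x} x−a∉Z = x − a , x−a∉Z , x≡a+[x−a] x a

  ¬InShiftN⇒∈ : ∀ {a x} → ¬ InShiftN K Z a x → x − a ∈ Z
  ¬InShiftN⇒∈ {a} {x} ∉shift = decidable-stable (x − a ∈? Z) (∉shift ∘ ∉⇒InShiftN)

  InShiftN? : ∀ a x → Dec (InShiftN K Z a x)
  InShiftN? a x = map′ ∉⇒InShiftN InShiftN⇒∉ (¬? (x − a ∈? Z))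

  InNewShift : ∀ {t} → Vector (Fin n) t → Fin n → Fin n → Set
  InNewShift α a y = InShiftN K Z a y × (∀ j → ¬ InShiftN K Z (α j) y)

  HasNRank? : ∀ t α → Dec (HasNRank K Z t α)
  HasNRank? t α = all? λ i → (1 ≤? toℕ i) →-dec
    any? λ x → InShiftN? (α i) x ×-dec all? λ j → (toℕ j <? toℕ i) →-dec ¬? (InShiftN? (α j) x)

  HasNRank-resp : ∀ {t} {α β : Vector (Fin n) t} → α ≗ β → HasNRank K Z t α → HasNRank K Z t β
  HasNRank-resp α≗β r i 1≤i = let (x , x∈ , x∉) = r i 1≤i in
    x , InShiftN-cong (α≗β i) x∈ , λ j j<i → x∉ j j<i ∘ InShiftN-cong (sym (α≗β j))

  HasNRank-init : ∀ {t} {α : Vector (Fin n) (suc t)} →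
                  HasNRank K Z (suc t) α → HasNRank K Z t (init α)
  HasNRank-init r i 1≤i =
    let (x , x∈ , x∉) = r (inject₁ i) (subst (1 ≤_) (sym (toℕ-inject₁ i)) 1≤i) in
    x , x∈ , λ j j<i → x∉ (inject₁ j) (subst₂ _<_ (sym (toℕ-inject₁ j)) (sym (toℕ-inject₁ i)) j<i)

  -- For a single term the rank condition is vacuous: any point of last α + 𝒩 will do, and 𝒩 ≠ ∅.
  HasNRank-last : (∃ λ x → x ∉ Z) → ∀ {t} {α : Vector (Fin n) (suc t)} →
                  HasNRank K Z (suc t) α → ∃ (InNewShift (init α) (last α))
  HasNRank-last (x₀ , x₀∉Z) {zero} {α} r = last α + x₀ , (x₀ , x₀∉Z , refl) , λ ()
  HasNRank-last _ {suc t} r = let (y , y∈ , y∉) = r (fromℕ (suc t)) (s≤s z≤n) in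
    y , y∈ , λ j → y∉ (inject₁ j) (inject₁<fromℕ j)

  HasNRank-extend : ∀ {t} {α : Vector (Fin n) (suc t)} {y} →
    HasNRank K Z t (init α) → InNewShift (init α) (last α) y → HasNRank K Z (suc t) α
  HasNRank-extend {t} {α} {y} r (y∈ , y∉) i 1≤i with view i
  ... | ‵fromℕ = y , y∈ , before-last
    where
    before-last : ∀ j → toℕ j < toℕ (fromℕ t) → ¬ InShiftN K Z (α j) y
    before-last j j<last with view j
    ... | ‵fromℕ     = ⊥-elim (<-irrefl refl j<last)
    ... | ‵inject₁ k = y∉ k
  ... | ‵inject₁ k with r k (subst (1 ≤_) (toℕ-inject₁ k) 1≤i)
  ... | x , x∈ , x∉ = x , x∈ , before-k
    where
    before-k : ∀ j → toℕ j < toℕ (inject₁ k) → ¬ InShiftN K Z (α j) x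
    before-k j j<k with view j
    ... | ‵fromℕ     = ⊥-elim (<-asym j<k (inject₁<fromℕ k))
    ... | ‵inject₁ m = x∉ m (subst₂ _<_ (toℕ-inject₁ m) (toℕ-inject₁ k) j<k)

  HasNRank-∷ʳ : ∀ {t} {α : Vector (Fin n) t} {a y} →
                HasNRank K Z t α → InNewShift α a y → HasNRank K Z (suc t) (α ∷ʳ a)
  HasNRank-∷ʳ {α = α} {a} r (y∈ , y∉) = HasNRank-extend (HasNRank-resp (sym ∘ init-∷ʳ α a) r)
    (InShiftN-cong (sym (last-∷ʳ α a)) y∈ , λ j → y∉ j ∘ InShiftN-cong (init-∷ʳ α a j))

  HasNRank-injective : ∀ {t} {α : Vector (Fin n) t} → HasNRank K Z t α → Injective _≡_ _≡_ α
  HasNRank-injective r {i} {j} αi≡αj with <-cmp (toℕ i) (toℕ j)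
  ... | tri≈ _ i≡j _ = toℕ-injective i≡j
  ... | tri< i<j _ _ = let (x , x∈ , x∉) = r j (≤-trans (s≤s z≤n) i<j) in
    ⊥-elim (x∉ i i<j (InShiftN-cong (sym αi≡αj) x∈))
  ... | tri> _ _ j<i = let (x , x∈ , x∉) = r i (≤-trans (s≤s z≤n) j<i) in
    ⊥-elim (x∉ j j<i (InShiftN-cong αi≡αj x∈))

  HasNRank-bound : ∀ {t} {α : Vector (Fin n) t} → HasNRank K Z t α → t ≤ n
  HasNRank-bound {t} {α} r with t ≤? n
  ... | yes t≤n = t≤n
  ... | no t≰n = let (i , j , i<j , αi≡αj) = pigeonhole (≰⇒> t≰n) α in
    ⊥-elim (<⇒≢ i<j (HasNRank-injective r αi≡αj))

  maximal-rank : ∃ λ d → ∃ (HasNRank K Z d) × (∀ t → ∃ (HasNRank K Z t) → t ≤ d)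
  maximal-rank = largest (λ t → ∃ (HasNRank K Z t))
    (λ t → any-vector? t (HasNRank K Z t) HasNRank-resp (HasNRank? t))
    ((λ ()) , (λ ())) n (λ t (α , r) → HasNRank-bound r)

  −ˢ⊆ : ∀ {t} {α : Vector (Fin n) t} {y} → (∀ j → ¬ InShiftN K Z (α j) y) → (y −ˢ α) ⊆ Z
  −ˢ⊆ {α = α} {y} y∉ x∈ with ∈-−ˢ⁻ y α x∈
  ... | j , refl = ¬InShiftN⇒∈ (y∉ j)

  indep-−ˢ : ∀ c d {t} {α : Vector (Fin n) t} → IsIndep K Z (c −ˢ α) → IsIndep K Z (d −ˢ α)
  indep-−ˢ c d {α = α} ind = subst (λ e → IsIndep K Z (e −ˢ α)) (x−y+y≡x d c)
    (indep-trans (d − c) ind (−ˢ-translate (d − c) c α))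

  nRank⇒indep : (∃ λ x → x ∉ Z) → ∀ {t} {α : Vector (Fin n) t} →
                HasNRank K Z t α → ∀ c → IsIndep K Z (c −ˢ α)
  nRank⇒indep x₀ {zero}      r c = indep-∅
  nRank⇒indep x₀ {suc t} {α} r c with HasNRank-last x₀ r
  ... | y , y∈ , y∉ = indep-−ˢ y c {α = α}
    (indep-add (y − last α) (nRank⇒indep x₀ (HasNRank-init r) y) (−ˢ⊆ y∉) (InShiftN⇒∉ y∈))

  indep⇒nRank : ∀ {A} → IsIndep K Z A →
    ∃ λ t → Σ (Vector (Fin n) t) λ α → ∃ λ c → HasNRank K Z t α × A ≡ (c −ˢ α)
  indep⇒nRank indep-∅ = 0 , (λ ()) , 0# , (λ ()) , refl
  indep⇒nRank (indep-trans ψ ind T) with indep⇒nRank ind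
  ... | t , α , c , r , refl = t , α , ψ + c , r , IsTranslate-functional T (−ˢ-translate ψ c α)
  indep⇒nRank (indep-add η ind A⊆Z η∉Z) with indep⇒nRank ind
  ... | t , α , c , r , refl = suc t , α ∷ʳ (c − η) , c , HasNRank-∷ʳ r (c∈ , c∉) , A∪η≡
    where
    c∈ : InShiftN K Z (c − η) c
    c∈ = ∉⇒InShiftN (subst (_∉ Z) (sym (x−[x−y]≡y c η)) η∉Z)
    c∉ : ∀ j → ¬ InShiftN K Z (α j) c
    c∉ j c∈ = InShiftN⇒∉ c∈ (A⊆Z (∈-−ˢ⁺ c α j))
    A∪η≡ : (c −ˢ α) ∪ ⁅ η ⁆ ≡ (c −ˢ (α ∷ʳ (c − η)))
    A∪η≡ = cong₂ _∪_ (−ˢ-cong c (sym ∘ init-∷ʳ α (c − η)))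
      (cong ⁅_⁆ (sym (trans (cong (c −_) (last-∷ʳ α (c − η))) (x−[x−y]≡y c η))))

  indep-of-size : (∃ λ x → x ∉ Z) → ∀ {t} {α : Vector (Fin n) t} →
                  HasNRank K Z t α → ∃ λ A → IsIndep K Z A × ∣ A ∣ ≡ t
  indep-of-size x₀ {α = α} r = (0# −ˢ α) , nRank⇒indep x₀ r 0# , ∣−ˢ∣ 0# α (HasNRank-injective r)

  ∣indep∣≤ : ∀ {d A} → (∀ t → ∃ (HasNRank K Z t) → t ≤ d) → IsIndep K Z A → ∣ A ∣ ≤ d
  ∣indep∣≤ maximal ind with indep⇒nRank ind
  ... | t , α , c , r , refl =
    subst (_≤ _) (sym (∣−ˢ∣ c α (HasNRank-injective r))) (maximal t (α , r))

mainTheorem8 : ∀ {n : ℕ} (K : FinAbGroup n) (Z : Subset n) → (∃ λ x → x ∉ Z) →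
    ∃ λ d → IsDelta K Z d × IsMaxNRank K Z d
mainTheorem8 K Z x₀ =
  let (d , (α , r) , maximal) = maximal-rank in
  d , (indep-of-size x₀ r , λ A → ∣indep∣≤ maximal) , (α , r) , λ t → curry (maximal t)
  where open Correspondence K Z
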